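{- The function $g$ is a bijection from the set of non-negative integers to the set of non-negative integers that are not prime.
   Context: For a non-negative integer $n$, $g(n)$ is the least integer $k$ such that there exists a strictly increasing sequence of integers $n = a_1 < a_2 < \cdots < a_t = k$ ($t \geq 1$) whose product $a_1 a_2 \cdots a_t$ is a perfect square. -}

module Defs where

open import Data.Nat using (ℕ; _*_; _<_; _≤_)
open import Data.List using (List; _∷_; last)
open import Data.Nat.ListAction using (product)
open import Data.List.Relation.Unary.Linked using (Linked)
open import Data.Maybe using (just)
open import Data.Product using (Σ; ∃; _×_)
open import Relation.Binary.PropositionalEquality using (_≡_)

IsSquare : ℕ → Set
IsSquare x = ∃ λ m → m * m ≡ x

-- There is a strictly increasing sequence n = a₁ < a₂ < ⋯ < a_t = k (t ≥ 1)
-- whose product a₁ a₂ ⋯ a_t is a perfect square.  The sequence is n ∷ as.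
SquareChain : ℕ → ℕ → Set
SquareChain n k =
  Σ (List ℕ) λ as →
    Linked _<_ (n ∷ as) × last (n ∷ as) ≡ just k × IsSquare (product (n ∷ as))

IsG : ℕ → ℕ → Set
IsG n k = SquareChain n k × (∀ j → SquareChain n j → k ≤ j)

-- A chain n = a₁ < ⋯ < a_t = k with square product is a finite set of integers, and the product
-- of two finite sets is the product of their symmetric difference times a square.  If
-- g n = g n′ = k with n < n′, the symmetric difference of the two chains, with the common k
-- cancelled, is a chain from n ending below k, contradicting minimality.  For non-prime m let n₀
-- be the largest n with a chain from n to m; if g n₀ < m, combining a chain n₀ → g n₀ with a
-- chain n₀ → m cancels n₀ and leaves a chain to m starting above n₀, contradicting maximality.
-- Nor is g n a prime p: the chain's product is p times positive factors below p, and a square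
-- divisible by p is divisible by p².  All sets involved lie in a bounded window, so chains are
-- decidable and g is computable.

module Submission where

open import Defs
open import Data.Nat
open import Data.Nat.Properties
open import Data.Nat.Divisibility
open import Data.Nat.DivMod using (_/_; m/n*n≡m)
open import Data.Nat.GCD using (gcd; gcd[m,n]∣m; gcd[m,n]∣n; gcd[m,n]≢0)
open import Data.Nat.Coprimality using (coprime-/gcd; coprime-divisor)
open import Data.Nat.Primality
  using (Prime; Composite; composite; euclidsLemma; prime⇒nonZero; ¬prime[1]; ¬prime⇒composite)
open import Data.Nat.ListAction using (product)
open import Data.Nat.ListAction.Properties using (product-++)
open import Data.Nat.Induction using (<-rec)
open import Data.Nat.Solver using (module +-*-Solver)
open import Data.Bool using (_xor_)
open import Data.Fin.Subset using (Subset; inside; outside; _∩_)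
open import Data.Fin.Subset.Properties using (anySubset?)
open import Data.Vec using ([]; _∷_; zipWith)
open import Data.List using (List; []; _∷_; _∷ʳ_; last; initLast; _∷ʳ′_)
open import Data.List.Relation.Unary.All using (All; []; _∷_)
import Data.List.Relation.Unary.All as All
open import Data.List.Relation.Unary.Linked using (Linked; []; [-]; _∷_; tail)
open import Data.List.Relation.Unary.Linked.Properties using (Linked⇒All)
open import Data.Maybe using (just)
open import Data.Maybe.Properties using (just-injective)
open import Data.Product using (Σ; ∃; _×_; _,_; proj₁; proj₂)
open import Data.Sum using (_⊎_; inj₁; inj₂; [_,_]′)
open import Data.Empty using (⊥-elim)
open import Function using (_$_)
open import Function.Bundles using (_⇔_; mk⇔)
open import Function.Definitions using (Injective)
open import Function.Properties.Equivalence using () renaming (sym to ⇔-sym)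
open import Relation.Nullary using (¬_; yes; no; contradiction)
open import Relation.Nullary.Decidable using (Dec; map′; _×-dec_; _⊎-dec_)
import Relation.Nullary.Decidable as Dec
open import Relation.Unary using (Pred; Decidable)
open import Relation.Binary.Definitions using (tri<; tri≈; tri>)
open import Relation.Binary.PropositionalEquality
open +-*-Solver

IsSquare-* : ∀ {a b} → IsSquare a → IsSquare b → IsSquare (a * b)
IsSquare-* (r , refl) (s , refl) =
  r * s , solve 2 (λ r s → (r :* s) :* (r :* s) := (r :* r) :* (s :* s)) refl r s

-- With d = gcd m n, m = a d and n = b d for coprime a, b; then a² ∣ b² forces a ∣ b, so a = 1.
m*m∣n*n⇒m∣n : ∀ m n .{{_ : NonZero m}} → m * m ∣ n * n → m ∣ n
m*m∣n*n⇒m∣n m n mm∣nn = subst (_∣ n) d≡m (gcd[m,n]∣n m n)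
  where
  d = gcd m n
  instance
    d≢0 : NonZero d
    d≢0 = ≢-nonZero (gcd[m,n]≢0 m n (inj₁ (≢-nonZero⁻¹ m)))
  a = m / d
  b = n / d
  ad≡m : a * d ≡ m
  ad≡m = m/n*n≡m (gcd[m,n]∣m m n)
  bd≡n : b * d ≡ n
  bd≡n = m/n*n≡m (gcd[m,n]∣n m n)
  square-of-* : ∀ x y {z} → x * y ≡ z → x * x * (y * y) ≡ z * z
  square-of-* x y refl = solve 2 (λ x y → x :* x :* (y :* y) := (x :* y) :* (x :* y)) refl x y
  aa∣bb : a * a ∣ b * b
  aa∣bb = *-cancelʳ-∣ (d * d) {{m*n≢0 d d}}
    (subst₂ _∣_ (sym (square-of-* a d ad≡m)) (sym (square-of-* b d bd≡n)) mm∣nn)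
  a≡1 : a ≡ 1
  a≡1 = coprime-/gcd m n (∣-refl , coprime-divisor (coprime-/gcd m n) (∣-trans (m∣m*n a) aa∣bb))
  d≡m : d ≡ m
  d≡m = trans (sym (*-identityˡ d)) (trans (cong (_* d) (sym a≡1)) ad≡m)

IsSquare-cancelʳ : ∀ a c .{{_ : NonZero c}} → IsSquare (a * (c * c)) → IsSquare a
IsSquare-cancelʳ a c (r , rr≡acc) = root (m*m∣n*n⇒m∣n c r (divides a rr≡acc))
  where
  root : c ∣ r → IsSquare a
  root (divides q r≡qc) = q , *-cancelʳ-≡ (q * q) a (c * c) {{m*n≢0 c c}} (begin
    q * q * (c * c)       ≡⟨ solve 2 (λ q c → q :* q :* (c :* c) := (q :* c) :* (q :* c)) refl q c ⟩
    (q * c) * (q * c)     ≡⟨ cong (λ x → x * x) r≡qc ⟨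
    r * r                 ≡⟨ rr≡acc ⟩
    a * (c * c)           ∎)
    where open ≡-Reasoning

IsSquare[a*p]⇒p∣a : ∀ {a p} → Prime p → IsSquare (a * p) → p ∣ a
IsSquare[a*p]⇒p∣a {a} {p} pp (r , rr≡ap) = [ p∣a , p∣a ]′ (euclidsLemma r r pp (divides a rr≡ap))
  where
  instance _ = prime⇒nonZero pp
  p∣a : p ∣ r → p ∣ a
  p∣a (divides q r≡qp) = divides (q * q) (*-cancelʳ-≡ a (q * q * p) p (begin
    a * p                 ≡⟨ rr≡ap ⟨
    r * r                 ≡⟨ cong (λ x → x * x) r≡qp ⟩
    (q * p) * (q * p)     ≡⟨ solve 2 (λ q p → (q :* p) :* (q :* p) := q :* q :* p :* p) refl q p ⟩
    q * q * p * p         ∎))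
    where open ≡-Reasoning

IsSquare⇒¬Prime : ∀ {a} → IsSquare a → ¬ Prime a
IsSquare⇒¬Prime {a} sq pa =
  ¬prime[1] (subst Prime (∣1⇒≡1 (IsSquare[a*p]⇒p∣a pa (subst IsSquare (sym (*-identityˡ a)) sq))) pa)

¬IsSquare⇒nonZero : ∀ {n} → ¬ IsSquare n → NonZero n
¬IsSquare⇒nonZero {zero} ¬sq = contradiction (0 , refl) ¬sq
¬IsSquare⇒nonZero {suc n} _ = _

isSquare? : Decidable IsSquare
isSquare? a = map′ (λ (r , _ , rr≡a) → r , rr≡a) (λ (r , rr≡a) → r , s≤s (root≤ r rr≡a) , rr≡a)
  (anyUpTo? (λ r → r * r ≟ a) (suc a))
  where
  root≤ : ∀ r → r * r ≡ a → r ≤ a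
  root≤ zero _ = z≤n
  root≤ (suc r) refl = m≤m*n (suc r) (suc r)

last-∷ʳ : ∀ {A : Set} (xs : List A) {k} → last (xs ∷ʳ k) ≡ just k
last-∷ʳ [] = refl
last-∷ʳ (x ∷ []) = refl
last-∷ʳ (x ∷ y ∷ ys) = last-∷ʳ (y ∷ ys)

product-∷ʳ : ∀ xs k → product (xs ∷ʳ k) ≡ product xs * k
product-∷ʳ xs k = trans (product-++ xs (k ∷ [])) (cong (product xs *_) (*-identityʳ k))

last-All : ∀ {P : ℕ → Set} {x xs} → All P (x ∷ xs) → ∃ λ j → last (x ∷ xs) ≡ just j × P j
last-All {xs = []} (px ∷ []) = _ , refl , px
last-All {xs = y ∷ ys} (_ ∷ pys) = last-All pys

Linked-< : ∀ {x xs} → Linked _<_ (x ∷ xs) → All (x <_) xs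
Linked-< [-] = []
Linked-< (x<y ∷ ys↗) = Linked⇒All <-trans x<y ys↗

Linked-≤last : ∀ {x xs k} → Linked _<_ (x ∷ xs) → last (x ∷ xs) ≡ just k → All (_≤ k) (x ∷ xs)
Linked-≤last [-] refl = ≤-refl ∷ []
Linked-≤last (x<y ∷ ys↗) eq with Linked-≤last ys↗ eq
... | y≤k ∷ ys≤k = ≤-trans (<⇒≤ x<y) y≤k ∷ y≤k ∷ ys≤k

Linked-∷ʳ⁺ : ∀ {xs k} → Linked _<_ xs → All (_< k) xs → Linked _<_ (xs ∷ʳ k)
Linked-∷ʳ⁺ [] [] = [-]
Linked-∷ʳ⁺ [-] (x<k ∷ []) = x<k ∷ [-]
Linked-∷ʳ⁺ (x<y ∷ ys↗) (_ ∷ ys<k) = x<y ∷ Linked-∷ʳ⁺ ys↗ ys<k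

Linked-∷ʳ⁻ : ∀ xs {k} → Linked _<_ (xs ∷ʳ k) → Linked _<_ xs × All (_< k) xs
Linked-∷ʳ⁻ [] _ = [] , []
Linked-∷ʳ⁻ (x ∷ []) (x<k ∷ [-]) = [-] , x<k ∷ []
Linked-∷ʳ⁻ (x ∷ y ∷ ys) (x<y ∷ ys↗) with Linked-∷ʳ⁻ (y ∷ ys) ys↗
... | ys↗′ , y<k ∷ ys<k = x<y ∷ ys↗′ , <-trans x<y y<k ∷ y<k ∷ ys<k

prime∤product : ∀ {p xs} → Prime p → All NonZero xs → All (_< p) xs → ¬ p ∣ product xs
prime∤product pp [] [] p∣1 = ¬prime[1] (subst Prime (∣1⇒≡1 p∣1) pp)
prime∤product {xs = x ∷ xs} pp (x≢0 ∷ xs≢0) (x<p ∷ xs<p) p∣x*xs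
  with euclidsLemma x (product xs) pp p∣x*xs
... | inj₁ p∣x = >⇒∤ {{x≢0}} x<p p∣x
... | inj₂ p∣xs = prime∤product pp xs≢0 xs<p p∣xs

-- A subset v of the window [lo, lo + L) is a vector of L booleans, position i standing for lo + i.
members : ∀ {L} → Subset L → ℕ → List ℕ
members [] lo = []
members (inside ∷ v) lo = lo ∷ members v (suc lo)
members (outside ∷ v) lo = members v (suc lo)

∏ : ∀ {L} → Subset L → ℕ → ℕ
∏ v lo = product (members v lo)

_⊕_ : ∀ {L} → Subset L → Subset L → Subset L
_⊕_ = zipWith _xor_

members-Linked : ∀ {L x lo} (v : Subset L) → x < lo → Linked _<_ (x ∷ members v lo)
members-Linked [] x<lo = [-]
members-Linked (inside ∷ v) x<lo = x<lo ∷ members-Linked v ≤-refl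
members-Linked (outside ∷ v) x<lo = members-Linked v (m<n⇒m<1+n x<lo)

members-< : ∀ {L lo hi} (v : Subset L) → lo + L ≡ hi → All (_< hi) (members v lo)
members-< [] _ = []
members-< {suc L} {lo} (inside ∷ v) lo+L≡hi =
  subst (lo <_) lo+L≡hi (m<m+n lo z<s) ∷ members-< v (trans (sym (+-suc lo L)) lo+L≡hi)
members-< {suc L} {lo} (outside ∷ v) lo+L≡hi = members-< v (trans (sym (+-suc lo L)) lo+L≡hi)

members-surjective : ∀ L lo {hi xs} → lo + L ≡ hi → Linked _<_ xs → All (lo ≤_) xs → All (_< hi) xs →
                     ∃ λ (v : Subset L) → members v lo ≡ xs
members-surjective zero lo {xs = []} _ _ _ _ = [] , refl
members-surjective zero lo {xs = x ∷ _} lo+0≡hi _ (lo≤x ∷ _) (x<hi ∷ _) =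
  contradiction (subst (x <_) (trans (sym lo+0≡hi) (+-identityʳ lo)) x<hi) (≤⇒≯ lo≤x)
members-surjective (suc L) lo {xs = []} lo+L≡hi _ _ _ =
  let v , eq = members-surjective L (suc lo) (trans (sym (+-suc lo L)) lo+L≡hi) [] [] [] in outside ∷ v , eq
members-surjective (suc L) lo {xs = x ∷ ys} lo+L≡hi xs↗ (lo≤x ∷ _) xs<hi = go (m≤n⇒m<n∨m≡n lo≤x)
  where
  shifted : suc lo + L ≡ _
  shifted = trans (sym (+-suc lo L)) lo+L≡hi
  go : lo < x ⊎ lo ≡ x → ∃ λ (v : Subset (suc L)) → members v lo ≡ x ∷ ys
  go (inj₂ refl) =
    let v , eq = members-surjective L (suc lo) shifted (tail xs↗) (Linked-< xs↗) (All.tail xs<hi)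
    in inside ∷ v , cong (lo ∷_) eq
  go (inj₁ lo<x) =
    let v , eq = members-surjective L (suc lo) shifted xs↗ (lo<x ∷ All.map (<-trans lo<x) (Linked-< xs↗)) xs<hi
    in outside ∷ v , eq

∏≢0 : ∀ {L} (v : Subset L) lo .{{_ : NonZero lo}} → NonZero (∏ v lo)
∏≢0 [] lo = _
∏≢0 (inside ∷ v) lo = m*n≢0 lo (∏ v (suc lo))
  where instance _ = ∏≢0 v (suc lo)
∏≢0 (outside ∷ v) lo = ∏≢0 v (suc lo)

module _ (l a b x c : ℕ) (ab≡xcc : a * b ≡ x * (c * c)) where

  scale-both : (l * a) * (l * b) ≡ x * ((l * c) * (l * c))
  scale-both = begin
    (l * a) * (l * b)       ≡⟨ solve 3 (λ l a b → (l :* a) :* (l :* b) := (a :* b) :* (l :* l)) refl l a b ⟩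
    (a * b) * (l * l)       ≡⟨ cong (_* (l * l)) ab≡xcc ⟩
    x * (c * c) * (l * l)   ≡⟨ solve 3 (λ l x c → x :* (c :* c) :* (l :* l) := x :* ((l :* c) :* (l :* c)))
                                       refl l x c ⟩
    x * ((l * c) * (l * c)) ∎
    where open ≡-Reasoning

  scale : l * (a * b) ≡ (l * x) * (c * c)
  scale = trans (cong (l *_) ab≡xcc) (sym (*-assoc l x _))

  scale-left : (l * a) * b ≡ (l * x) * (c * c)
  scale-left = trans (*-assoc l a b) scale

  scale-right : a * (l * b) ≡ (l * x) * (c * c)
  scale-right = trans (solve 3 (λ l a b → a :* (l :* b) := l :* (a :* b)) refl l a b) scale

∏-⊕ : ∀ {L} (u v : Subset L) lo →
      ∏ u lo * ∏ v lo ≡ ∏ (u ⊕ v) lo * (∏ (u ∩ v) lo * ∏ (u ∩ v) lo)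
∏-⊕ [] [] lo = refl
∏-⊕ (p ∷ u) (q ∷ v) lo = step p q
  where
  a = ∏ u (suc lo)
  b = ∏ v (suc lo)
  x = ∏ (u ⊕ v) (suc lo)
  c = ∏ (u ∩ v) (suc lo)
  ih : a * b ≡ x * (c * c)
  ih = ∏-⊕ u v (suc lo)
  step : ∀ p q → let u′ = p ∷ u; v′ = q ∷ v in
                 ∏ u′ lo * ∏ v′ lo ≡ ∏ (u′ ⊕ v′) lo * (∏ (u′ ∩ v′) lo * ∏ (u′ ∩ v′) lo)
  step inside  inside  = scale-both  lo a b x c ih
  step inside  outside = scale-left  lo a b x c ih
  step outside inside  = scale-right lo a b x c ih
  step outside outside = ih

IsSquare-⊕ : ∀ {L} (u v : Subset L) lo .{{_ : NonZero lo}} a b →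
             IsSquare (a * ∏ u lo) → IsSquare (b * ∏ v lo) → IsSquare (a * b * ∏ (u ⊕ v) lo)
IsSquare-⊕ u v lo a b sqᵤ sqᵥ =
  IsSquare-cancelʳ (a * b * ∏ (u ⊕ v) lo) (∏ (u ∩ v) lo) {{∏≢0 (u ∩ v) lo}}
    (subst IsSquare (begin
      (a * ∏ u lo) * (b * ∏ v lo)                              ≡⟨ regroup a b (∏ u lo) (∏ v lo) ⟩
      a * b * (∏ u lo * ∏ v lo)                                ≡⟨ cong (a * b *_) (∏-⊕ u v lo) ⟩
      a * b * (∏ (u ⊕ v) lo * (∏ (u ∩ v) lo * ∏ (u ∩ v) lo))   ≡⟨ *-assoc (a * b) _ _ ⟨
      a * b * ∏ (u ⊕ v) lo * (∏ (u ∩ v) lo * ∏ (u ∩ v) lo)     ∎)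
    (IsSquare-* sqᵤ sqᵥ))
  where
  open ≡-Reasoning
  regroup : ∀ a b U V → (a * U) * (b * V) ≡ a * b * (U * V)
  regroup = solve 4 (λ a b U V → (a :* U) :* (b :* V) := a :* b :* (U :* V)) refl

Between : ℕ → ℕ → List ℕ → Set
Between n k xs = Linked _<_ (n ∷ xs) × All (_< k) xs

members-Between : ∀ {n k} → n < k → (v : Subset (k ∸ suc n)) → Between n k (members v (suc n))
members-Between n<k v = members-Linked v ≤-refl , members-< v (m+[n∸m]≡n n<k)

Between⇒members : ∀ {n k xs} → n < k → Between n k xs →
                  ∃ λ (v : Subset (k ∸ suc n)) → members v (suc n) ≡ xs
Between⇒members {n} {k} n<k (↗ , <k) =
  members-surjective (k ∸ suc n) (suc n) (m+[n∸m]≡n n<k) (tail ↗) (Linked-< ↗) <k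

symmetric-difference : ∀ {n k I J} a b → n < k → Between n k I → Between n k J →
  IsSquare (a * product I) → IsSquare (b * product J) → ∃ λ D → Between n k D × IsSquare (a * b * product D)
symmetric-difference {n} a b n<k I∈ J∈ sqI sqJ with Between⇒members n<k I∈ | Between⇒members n<k J∈
... | u , refl | v , refl =
  members (u ⊕ v) (suc n) , members-Between n<k (u ⊕ v) , IsSquare-⊕ u v (suc n) a b sqI sqJ

square⇒chain : ∀ {n} → IsSquare n → SquareChain n n
square⇒chain {n} sq = [] , [-] , refl , subst IsSquare (sym (*-identityʳ n)) sq

interior⇒chain : ∀ {n k I} → n < k → Between n k I → IsSquare (n * product I * k) → SquareChain n k
interior⇒chain {n} {k} {I} n<k (↗ , I<k) sq =
  I ∷ʳ k , Linked-∷ʳ⁺ ↗ (n<k ∷ I<k) , last-∷ʳ (n ∷ I) ,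
  subst IsSquare (sym (product-∷ʳ (n ∷ I) k)) sq

chain⇒interior : ∀ {n k} → SquareChain n k →
  (n ≡ k × IsSquare k) ⊎ (n < k × ∃ λ I → Between n k I × IsSquare (n * product I * k))
chain⇒interior {n} {k} (as , ↗ , last≡k , sq) with initLast as
... | [] with just-injective last≡k
...   | refl = inj₁ (refl , subst IsSquare (*-identityʳ n) sq)
chain⇒interior {n} {k} (_ , ↗ , last≡k , sq) | I ∷ʳ′ y with trans (sym (last-∷ʳ (n ∷ I))) last≡k
...   | refl with Linked-∷ʳ⁻ (n ∷ I) ↗
...     | ↗′ , n<k ∷ I<k = inj₂ (n<k , I , (↗′ , I<k) , subst IsSquare (product-∷ʳ (n ∷ I) k) sq)

chain-≤ : ∀ {n k} → SquareChain n k → n ≤ k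
chain-≤ (_ , ↗ , last≡k , _) = All.head (Linked-≤last ↗ last≡k)

SubsetChain : ℕ → ℕ → Set
SubsetChain n k =
  (n ≡ k × IsSquare k) ⊎ (n < k × ∃ λ (v : Subset (k ∸ suc n)) → IsSquare (n * ∏ v (suc n) * k))

SquareChain⇔SubsetChain : ∀ {n k} → SquareChain n k ⇔ SubsetChain n k
SquareChain⇔SubsetChain {n} {k} = mk⇔ to from
  where
  to : SquareChain n k → SubsetChain n k
  to c with chain⇒interior c
  ... | inj₁ n≡k,sq = inj₁ n≡k,sq
  ... | inj₂ (n<k , I , I∈ , sq) with Between⇒members n<k I∈
  ...   | v , refl = inj₂ (n<k , v , sq)
  from : SubsetChain n k → SquareChain n k
  from (inj₁ (refl , sq)) = square⇒chain sq
  from (inj₂ (n<k , v , sq)) = interior⇒chain n<k (members-Between n<k v) sq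

squareChain? : ∀ n k → Dec (SquareChain n k)
squareChain? n k = Dec.map (⇔-sym SquareChain⇔SubsetChain)
  ((n ≟ k ×-dec isSquare? k) ⊎-dec (n <? k ×-dec anySubset? (λ v → isSquare? _)))

module _ {p} {P : Pred ℕ p} (P? : Decidable P) where

  least : ∀ {w} → P w → Σ ℕ λ k → P k × (∀ j → P j → k ≤ j)
  least {w} = <-rec (λ w → P w → Σ ℕ λ k → P k × (∀ j → P j → k ≤ j)) step w
    where
    step : ∀ w → (∀ {v} → v < w → P v → Σ ℕ λ k → P k × (∀ j → P j → k ≤ j)) →
           P w → Σ ℕ λ k → P k × (∀ j → P j → k ≤ j)
    step w smaller Pw with anyUpTo? P? w
    ... | yes (v , v<w , Pv) = smaller v<w Pv
    ... | no ¬below = w , Pw , λ j Pj → ≮⇒≥ (λ j<w → ¬below (j , j<w , Pj))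

  greatest : ∀ b → ∃ (λ w → w ≤ b × P w) →
             Σ ℕ λ k → k ≤ b × P k × (∀ {j} → j ≤ b → P j → j ≤ k)
  greatest b w with P? b
  ... | yes Pb = b , ≤-refl , Pb , λ j≤b _ → j≤b
  greatest zero (w , z≤n , Pw) | no ¬P0 = contradiction Pw ¬P0
  greatest (suc b) (w , w≤1+b , Pw) | no ¬Pb =
    let k , k≤b , Pk , maximal = greatest b (w , below w≤1+b Pw , Pw)
    in k , m≤n⇒m≤1+n k≤b , Pk , λ j≤1+b Pj → maximal (below j≤1+b Pj) Pj
    where
    below : ∀ {j} → j ≤ suc b → P j → j ≤ b
    below j≤1+b Pj with m≤n⇒m<n∨m≡n j≤1+b
    ... | inj₁ j<1+b = s≤s⁻¹ j<1+b
    ... | inj₂ refl = contradiction Pj ¬Pb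

-- n · 4n = (2n)², so g n ≤ 4n.
chain-to-*4 : ∀ n → SquareChain n (n * 4)
chain-to-*4 zero = square⇒chain (0 , refl)
chain-to-*4 n@(suc _) = interior⇒chain (m<m*n n 4 (s≤s (s≤s z≤n))) ([-] , [])
  (n * 2 , solve 1 (λ n → (n :* con 2) :* (n :* con 2) := n :* con 1 :* (n :* con 4)) refl n)

g : ℕ → ℕ
g n = proj₁ (least (squareChain? n) (chain-to-*4 n))

g-IsG : ∀ n → IsG n (g n)
g-IsG n = proj₂ (least (squareChain? n) (chain-to-*4 n))

IsG-unique : ∀ {n k k′} → IsG n k → IsG n k′ → k ≡ k′
IsG-unique (c , minimal) (c′ , minimal′) = ≤-antisym (minimal _ c′) (minimal′ _ c)

IsG-¬IsSquare : ∀ {n k} → IsG n k → n < k → ¬ IsSquare n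
IsG-¬IsSquare (_ , minimal) n<k sq = <⇒≱ n<k (minimal _ (square⇒chain sq))

IsG⇒¬Prime : ∀ {n k} → IsG n k → ¬ Prime k
IsG⇒¬Prime G@(c , _) pk with chain⇒interior c
... | inj₁ (refl , sq) = IsSquare⇒¬Prime sq pk
... | inj₂ (n<k , I , (↗ , I<k) , sq) =
  prime∤product pk (n≢0 ∷ All.map (λ n<i → ≢-nonZero (m<n⇒n≢0 n<i)) (Linked-< ↗)) (n<k ∷ I<k)
    (IsSquare[a*p]⇒p∣a pk sq)
  where
  n≢0 : NonZero _
  n≢0 = ¬IsSquare⇒nonZero (IsG-¬IsSquare G n<k)

chain-below-top : ∀ {n n′ k} → n < n′ → SquareChain n′ k →
                  ∃ λ J → Between n k J × IsSquare (k * product J)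
chain-below-top {n′ = n′} {k} n<n′ c with chain⇒interior c
... | inj₁ (refl , sq) = [] , ([-] , []) , subst IsSquare (sym (*-identityʳ _)) sq
... | inj₂ (n′<k , I , (↗ , I<k) , sq) =
  n′ ∷ I , (n<n′ ∷ ↗ , n′<k ∷ I<k) , subst IsSquare (*-comm (n′ * product I) k) sq

chain-ending-below : ∀ {n k D} → n < k → Between n k D → IsSquare (n * product D) →
                     ∃ λ j → j < k × SquareChain n j
chain-ending-below n<k (D↗ , D<k) sq with last-All (n<k ∷ D<k)
... | j , last≡j , j<k = j , j<k , (_ , D↗ , last≡j , sq)

IsG⇒¬chain-from-above : ∀ {n n′ k} → IsG n k → n < n′ → ¬ SquareChain n′ k
IsG⇒¬chain-from-above {n} {n′} {k} (c₁ , minimal) n<n′ c₂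
  with chain⇒interior c₁ | chain-below-top n<n′ c₂
... | inj₁ (refl , _) | _ = <⇒≱ n<n′ (chain-≤ c₂)
... | inj₂ (n<k , I , I∈ , sqI) | J , J∈ , sqJ =
  let D , D∈ , sqD = symmetric-difference (n * k) k n<k I∈ J∈ (subst IsSquare (swap-k (product I)) sqI) sqJ
      j , j<k , cⱼ = chain-ending-below n<k D∈ (cancel-k (product D) sqD)
  in <⇒≱ j<k (minimal j cⱼ)
  where
  instance _ = ≢-nonZero (m<n⇒n≢0 n<k)
  swap-k : ∀ i → n * i * k ≡ n * k * i
  swap-k i = solve 3 (λ n i k → n :* i :* k := n :* k :* i) refl n i k
  cancel-k : ∀ d → IsSquare (n * k * k * d) → IsSquare (n * d)
  cancel-k d sq = IsSquare-cancelʳ (n * d) k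
    (subst IsSquare (solve 3 (λ n d k → n :* k :* k :* d := n :* d :* (k :* k)) refl n d k) sq)

chain-starting-above : ∀ {n m D} → n < m → Between n m D → IsSquare (product D * m) →
                       ∃ λ x → n < x × SquareChain x m
chain-starting-above {m = m} n<m ([-] , []) sq = m , n<m , square⇒chain (subst IsSquare (*-identityˡ m) sq)
chain-starting-above n<m (n<x ∷ ↗ , x<m ∷ D<m) sq = _ , n<x , interior⇒chain x<m (↗ , D<m) sq

IsG-of-greatest-start : ∀ {n₀ k m} → .{{NonZero n₀}} → IsG n₀ k → SquareChain n₀ m →
                        (∀ {n} → n ≤ m → SquareChain n m → n ≤ n₀) → k ≡ m
IsG-of-greatest-start {n₀} {k} {m} ((as , ↗ , last≡k , sqas) , minimal) c₂ greatest-start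
  with m≤n⇒m<n∨m≡n (minimal m c₂) | chain⇒interior c₂
... | inj₂ k≡m | _ = k≡m
... | inj₁ k<m | inj₁ (refl , _) = contradiction k<m (≤⇒≯ (All.head (Linked-≤last ↗ last≡k)))
... | inj₁ k<m | inj₂ (n₀<m , J , J∈ , sqJ) =
  let D , D∈ , sqD = symmetric-difference n₀ (n₀ * m) n₀<m (↗ , as<m) J∈ sqas
                       (subst IsSquare (swap-m (product J)) sqJ)
      x , n₀<x , cₓ = chain-starting-above n₀<m D∈ (cancel-n₀ (product D) sqD)
  in contradiction (greatest-start (chain-≤ cₓ) cₓ) (<⇒≱ n₀<x)
  where
  as<m : All (_< m) as
  as<m = All.map (λ i≤k → ≤-<-trans i≤k k<m) (All.tail (Linked-≤last ↗ last≡k))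
  swap-m : ∀ j → n₀ * j * m ≡ n₀ * m * j
  swap-m j = solve 3 (λ n j m → n :* j :* m := n :* m :* j) refl n₀ j m
  cancel-n₀ : ∀ d → IsSquare (n₀ * (n₀ * m) * d) → IsSquare (d * m)
  cancel-n₀ d sq = IsSquare-cancelʳ (d * m) n₀
    (subst IsSquare (solve 3 (λ n m d → n :* (n :* m) :* d := d :* m :* (n :* n)) refl n₀ m d) sq)

two-factor-chain : ∀ {a b} → 1 < a → a < b → SquareChain a (b * a)
two-factor-chain {a} {b} 1<a a<b = interior⇒chain (<-trans a<b b<ba) (a<b ∷ [-] , b<ba ∷ [])
  (b * a , solve 2 (λ a b → (b :* a) :* (b :* a) := a :* (b :* con 1) :* (b :* a)) refl a b)
  where
  b<ba : b < b * a
  b<ba = m<m*n b a {{≢-nonZero (m<n⇒n≢0 (<-trans 1<a a<b))}} 1<a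

composite⇒chain : ∀ {m} → Composite m → ∃ λ n → 0 < n × SquareChain n m
composite⇒chain {m} (composite {d} d<m d∣m@(divides e m≡ed)) with <-cmp d e
... | tri< d<e _ _ = d , <-trans z<s 1<d , subst (SquareChain d) (sym m≡ed) (two-factor-chain 1<d d<e)
  where 1<d = nonTrivial⇒n>1 d
... | tri≈ _ refl _ = m , ≤-<-trans z≤n d<m , square⇒chain (d , sym m≡ed)
... | tri> _ _ e<d =
  e , <-trans z<s 1<e , subst (SquareChain e) (trans (*-comm d e) (sym m≡ed)) (two-factor-chain 1<e e<d)
  where 1<e = quotient>1 d∣m d<m

nonprime⇒chain : ∀ {m} → 0 < m → ¬ Prime m → ∃ λ n → 0 < n × SquareChain n m
nonprime⇒chain {1} _ _ = 1 , z<s , square⇒chain (1 , refl)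
nonprime⇒chain {suc (suc _)} _ ¬pm = composite⇒chain (¬prime⇒composite ¬pm)

IsG-surjective : ∀ m → ¬ Prime m → ∃ λ n → IsG n m
IsG-surjective zero _ = 0 , square⇒chain (0 , refl) , λ _ _ → z≤n
IsG-surjective m@(suc _) ¬pm =
  let n , 0<n , c = nonprime⇒chain z<s ¬pm
      n₀ , _ , c₀ , greatest-start = greatest (λ n → squareChain? n m) m (n , chain-≤ c , c)
      n₀≢0 = >-nonZero (<-≤-trans 0<n (greatest-start (chain-≤ c) c))
  in n₀ , subst (IsG n₀) (IsG-of-greatest-start {{n₀≢0}} (g-IsG n₀) c₀ greatest-start) (g-IsG n₀)

corollary1p14 : Σ (ℕ → ℕ) λ g →
    (∀ n → IsG n (g n))
    × Injective _≡_ _≡_ g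
    × (∀ n → ¬ Prime (g n))
    × (∀ m → ¬ Prime m → ∃ λ n → g n ≡ m)
corollary1p14 = g , g-IsG , g-injective , (λ n → IsG⇒¬Prime (g-IsG n)) , g-surjective
  where
  g-injective : Injective _≡_ _≡_ g
  g-injective {a} {b} ga≡gb with <-cmp a b
  ... | tri< a<b _ _ = ⊥-elim $
    IsG⇒¬chain-from-above (g-IsG a) a<b (subst (SquareChain b) (sym ga≡gb) (proj₁ (g-IsG b)))
  ... | tri≈ _ a≡b _ = a≡b
  ... | tri> _ _ b<a = ⊥-elim $
    IsG⇒¬chain-from-above (g-IsG b) b<a (subst (SquareChain a) ga≡gb (proj₁ (g-IsG a)))
  g-surjective : ∀ m → ¬ Prime m → ∃ λ n → g n ≡ m
  g-surjective m ¬pm = let n , isG = IsG-surjective m ¬pm in n , IsG-unique (g-IsG n) isG
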